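{- Let $G$ be an odd cactus that is not a cycle, and let $E_B=\big(\bigcup_{S\in\mathcal{S}_1\cup\mathcal{S}_2}E(S)\big)\cup E_{\mathrm{cut}}$. Let $B$ be a block of $G$ whose corresponding node in the block-cut tree of $G$ is a leaf. Then $E(B)\cap E_B\neq\emptyset$.
   Context: All graphs are finite, simple, connected and non-empty. $\mathrm{cut}(G)$ is the set of cut vertices, $E_{\mathrm{cut}}$ the set of cut edges. A cactus is a graph in which every edge lies in at most one cycle (so each block is a cycle or a single edge); an odd cactus has no even cycle. A block is a maximal connected subgraph without a cut vertex of its own. The block-cut tree of $G$ has vertex set $\mathrm{cut}(G)\cup\mathcal{B}(G)$ ($\mathcal{B}(G)$ the blocks), a cut vertex being adjacent to a block iff it lies in that block. Antipodes: for an odd cycle $C$ and edge $v_2v_3\in E(C)$, the unique $v_1\in V(C)$ with $d(v_1,v_2)=d(v_1,v_3)$ is antipodal; $\mathrm{opp}(v_2v_3)=v_1$. $E_{\mathrm{ant}}$ is the set of edges $e$ on cycles with $\mathrm{opp}(e)\in\mathrm{cut}(G)$. Cycle segments: for each cycle $C$ fix a cyclic orientation; $W=x_1\dots x_{2n(C)+1}$ is the closed trail around $C$ in that orientation, alternating vertices and edges, with $x_1=x_{2n(C)+1}\in\mathrm{cut}(G)$, $n(C)=|V(C)|$. A cycle segment of $C$ is a subsequence $S=x_j\dots x_{j+k}$ ($2\le j$, $j+k\le 2n(C)$) with $x_{j-1},x_{j+k+1}\in\mathrm{cut}(G)\cup E_{\mathrm{ant}}$ and no $x_{j+\ell}$ ($0\le\ell\le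 k$) in $\mathrm{cut}(G)\cup E_{\mathrm{ant}}$; $E(S)$ is its set of edges. $\mathcal{S}_1$: $x_{j-1},x_{j+k+1}\in\mathrm{cut}(G)$; $\mathcal{S}_2$: $x_{j-1}\in\mathrm{cut}(G)$, $x_{j+k+1}\in E_{\mathrm{ant}}$. -}

module Defs where

open import Data.Nat using (ℕ; zero; suc; _+_; _*_; _∸_; _≤_)
open import Data.Nat.DivMod using (_mod_)
open import Data.Fin using (Fin)
open import Data.Fin.Subset using (Subset; _∈_; _⊆_)
open import Data.Vec using (Vec; lookup)
open import Data.Product using (Σ; ∃; ∃-syntax; _×_; _,_; proj₁; proj₂)
open import Data.Sum using (_⊎_; inj₁; inj₂)
open import Data.Unit using (⊤)
open import Data.Empty using (⊥)
open import Relation.Nullary using (¬_)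
open import Relation.Binary.PropositionalEquality using (_≡_; _≢_)

record Graph : Set where
  field
    n    : ℕ
    m    : ℕ
    ends : Fin m → Fin n × Fin n
    loopless : ∀ e → proj₁ (ends e) ≢ proj₂ (ends e)

  Joins : Fin m → Fin n → Fin n → Set
  Joins e x y = (ends e ≡ (x , y)) ⊎ (ends e ≡ (y , x))

  field
    noParallel : ∀ e f x y → Joins e x y → Joins f x y → e ≡ f

module _ (G : Graph) where
  open Graph G

  data Walk (okV : Fin n → Set) (okE : Fin m → Set) : Fin n → Fin n → ℕ → Set where
    nil  : ∀ {x} → okV x → Walk okV okE x x zero
    cons : ∀ {x y z k} (e : Fin m) → okE e → Joins e x y → okV x →
           Walk okV okE y z k → Walk okV okE x z (suc k)

  ConnectedOn : (Fin n → Set) → (Fin m → Set) → Set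
  ConnectedOn VP EP =
    (∃[ v ] VP v) ×
    (∀ x y → VP x → VP y → ∃[ k ] Walk VP EP x y k)

  CutVertexOn : (Fin n → Set) → (Fin m → Set) → Fin n → Set
  CutVertexOn VP EP v =
    VP v × (∃[ x ] ∃[ y ] (VP x × VP y × x ≢ v × y ≢ v ×
             ¬ (∃[ k ] Walk (λ u → VP u × u ≢ v) EP x y k)))

  AllV : Fin n → Set
  AllV _ = ⊤

  AllE : Fin m → Set
  AllE _ = ⊤

  Connected : Set
  Connected = ConnectedOn AllV AllE

  IsCut : Fin n → Set
  IsCut = CutVertexOn AllV AllE

  IsCutEdge : Fin m → Set
  IsCutEdge e = ∃[ x ] ∃[ y ] ¬ (∃[ k ] Walk AllV (λ f → f ≢ e) x y k)

  Dist : Fin n → Fin n → ℕ → Set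
  Dist x y k = Walk AllV AllE x y k × (∀ k' → Walk AllV AllE x y k' → k ≤ k')

  -- The sequence also fixes a cyclic orientation and a starting vertex.
  record Cycle : Set where
    constructor mkCycle
    field
      l  : ℕ
      vs : Vec (Fin n) (3 + l)
      es : Vec (Fin m) (3 + l)

    len : ℕ
    len = 3 + l

    vert : ℕ → Fin n
    vert i = lookup vs (i mod len)

    edge : ℕ → Fin m
    edge i = lookup es (i mod len)

  open Cycle public

  IsCycle : Cycle → Set
  IsCycle C =
    (∀ i j → lookup (vs C) i ≡ lookup (vs C) j → i ≡ j) ×
    (∀ (i : ℕ) → Joins (edge C i) (vert C i) (vert C (suc i)))

  _∈V_ : Fin n → Cycle → Set
  v ∈V C = ∃[ i ] lookup (vs C) i ≡ v

  _∈E_ : Fin m → Cycle → Set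
  e ∈E C = ∃[ i ] lookup (es C) i ≡ e

  OnCycle : Fin m → Set
  OnCycle e = ∃[ C ] (IsCycle C × e ∈E C)

  -- every edge lies in at most one cycle (cycles sharing an edge have
  -- the same edge set, i.e. are the same subgraph), and no even cycle
  OddCactus : Set
  OddCactus =
    (∀ C D e → IsCycle C → IsCycle D → e ∈E C → e ∈E D →
       ∀ f → (f ∈E C → f ∈E D) × (f ∈E D → f ∈E C)) ×
    (∀ C → IsCycle C → ∃[ t ] len C ≡ suc (2 * t))

  IsCycleGraph : Set
  IsCycleGraph = ∃[ C ] (IsCycle C × (∀ v → v ∈V C) × (∀ e → e ∈E C))

  IsAntipode : Cycle → Fin m → Fin n → Set
  IsAntipode C e v = v ∈V C × ∃[ k ] (Dist v (proj₁ (ends e)) k × Dist v (proj₂ (ends e)) k)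

  InEant : Fin m → Set
  InEant e = ∃[ C ] (IsCycle C × e ∈E C × ∃[ v ] (IsAntipode C e v × IsCut v))

  -- The closed trail W = x_1 … x_{2 n(C) + 1}, items are vertices (inj₁)
  -- or edges (inj₂).
  Item : Set
  Item = Fin n ⊎ Fin m

  -- 0-based: item 2i = vertex i, item 2i+1 = edge i
  itemAux : Cycle → ℕ → ℕ → Item
  itemAux C i zero = inj₁ (vert C i)
  itemAux C i (suc zero) = inj₂ (edge C i)
  itemAux C i (suc (suc p)) = itemAux C (suc i) p

  -- x_p (1-based, meaningful for 1 ≤ p ≤ 2 n(C) + 1)
  x : Cycle → ℕ → Item
  x C p = itemAux C 0 (p ∸ 1)

  CutItem : Item → Set
  CutItem (inj₁ v) = IsCut v
  CutItem (inj₂ _) = ⊥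

  AntItem : Item → Set
  AntItem (inj₁ _) = ⊥
  AntItem (inj₂ e) = InEant e

  Marked : Item → Set
  Marked i = CutItem i ⊎ AntItem i

  -- S = x_j … x_{j+k} is a cycle segment of C
  IsSegment : Cycle → ℕ → ℕ → Set
  IsSegment C j k =
    2 ≤ j × j + k ≤ 2 * len C ×
    Marked (x C (j ∸ 1)) × Marked (x C (j + k + 1)) ×
    (∀ ℓ → ℓ ≤ k → ¬ Marked (x C (j + ℓ)))

  InS₁ : Cycle → ℕ → ℕ → Set
  InS₁ C j k = IsSegment C j k × CutItem (x C (j ∸ 1)) × CutItem (x C (j + k + 1))

  InS₂ : Cycle → ℕ → ℕ → Set
  InS₂ C j k = IsSegment C j k × CutItem (x C (j ∸ 1)) × AntItem (x C (j + k + 1))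

  InSegEdges : Cycle → ℕ → ℕ → Fin m → Set
  InSegEdges C j k e = ∃[ ℓ ] (ℓ ≤ k × x C (j + ℓ) ≡ inj₂ e)

  -- A fixed choice, for each cycle, of cyclic orientation and starting
  -- cut vertex x_1: represented by assigning to every edge on a cycle a
  -- cycle sequence through it, consistently on edges of the same cycle.
  record Orientation : Set where
    field
      W       : Fin m → Cycle
      valid   : ∀ e → OnCycle e → IsCycle (W e) × e ∈E W e × IsCut (lookup (vs (W e)) Data.Fin.zero)
      consistent : ∀ e f → OnCycle e → f ∈E W e → W f ≡ W e

  InEB : Orientation → Fin m → Set
  InEB O e =
    (∃[ f ] (OnCycle f × ∃[ j ] ∃[ k ]
        ((InS₁ (Orientation.W O f) j k ⊎ InS₂ (Orientation.W O f) j k) ×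
         InSegEdges (Orientation.W O f) j k e)))
    ⊎ IsCutEdge e

  record Subgraph : Set where
    field
      V : Subset n
      E : Subset m
      closed : ∀ e → e ∈ E → proj₁ (ends e) ∈ V × proj₂ (ends e) ∈ V

  open Subgraph public

  _≤H_ : Subgraph → Subgraph → Set
  H ≤H H' = (V H ⊆ V H') × (E H ⊆ E H')

  ConnectedNoCut : Subgraph → Set
  ConnectedNoCut H =
    ConnectedOn (_∈ V H) (_∈ E H) × (∀ v → ¬ CutVertexOn (_∈ V H) (_∈ E H) v)

  IsBlock : Subgraph → Set
  IsBlock B = ConnectedNoCut B × (∀ H → B ≤H H → ConnectedNoCut H → H ≤H B)

  -- adjacency in the block-cut tree between cut vertex c and block B
  BCAdj : Fin n → Subgraph → Set
  BCAdj c B = IsCut c × c ∈ V B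

  IsLeafBlock : Subgraph → Set
  IsLeafBlock B = ∃[ c ] (BCAdj c B × (∀ c' → BCAdj c' B → c' ≡ c))

module Submission where

-- Let c be the unique cut vertex of G in B.  A block is a maximal subgraph, so B is not
-- the lone vertex c and has an edge e₀ = cu at c.  If e₀ is a cut edge it lies in E_B.
-- Otherwise a shortest detour from u to c avoiding e₀ is a path, and e₀ followed by it is a
-- cycle C.  Adding a path between two vertices of a block to the block creates neither a
-- disconnection nor a cut vertex, so by maximality C lies in B.  The oriented cycle
-- D = W(e₀) shares e₀ with C, hence (cactus) has the same edges; every cycle meeting D lies
-- in B as well, and the only cut vertex of G inside B is c.  Therefore D starts at x₁ = c,
-- its marked items are c and the edges equidistant from c, markedness is decidable, and
-- x₂ (the first edge, incident with c) is unmarked.  The first marked item after x₂ closes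
-- a segment of 𝒮₁ ∪ 𝒮₂ starting at x₂, and x₂ ∈ E(B).

open import Defs
open import Data.Fin.Subset using (_∈_)
open import Data.Product using (∃-syntax; _×_)
open import Relation.Nullary using (¬_)

open import Data.Bool using (true)
open import Data.Empty using (⊥; ⊥-elim)
open import Data.Fin as F using (Fin; toℕ)
open import Data.Fin.Properties using (any?; toℕ-injective; toℕ<n; toℕ-fromℕ<; injective⇒≤)
open import Data.Fin.Subset using (Subset)
open import Data.Fin.Subset.Properties using (_∈?_)
open import Data.Nat using (ℕ; zero; suc; _+_; _*_; _∸_; _≤_; _<_; z≤n; s≤s; s≤s⁻¹)
open import Data.Nat.DivMod using (_mod_; _%_; n%n≡0; m<n⇒m%n≡m; m%n<n; %-distribˡ-+)
open import Data.Nat.Properties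
open import Data.Product using (Σ-syntax; _,_; proj₁; proj₂)
open import Data.Product.Properties using (≡-dec)
open import Data.Sum using (_⊎_; inj₁; inj₂)
open import Data.Unit using (⊤; tt)
open import Data.Vec using (lookup; tabulate)
open import Data.Vec.Properties using (lookup∘tabulate; []=⇒lookup; lookup⇒[]=)
open import Relation.Nullary using (Dec; yes; no; does)
open import Relation.Nullary.Decidable using (_×-dec_; _⊎-dec_; ¬?; dec-true; map′)
open import Relation.Binary.PropositionalEquality

-- Bounded search with an inclusive bound (the library's anyUpTo? has a strict one).
anyUpTo≤? : {P : ℕ → Set} → (∀ t → Dec (P t)) → ∀ k → Dec (∃[ t ] (t ≤ k × P t))
anyUpTo≤? P? k = map′ (λ (t , t<1+k , p) → t , s≤s⁻¹ t<1+k , p)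
                      (λ (t , t≤k , p) → t , s≤s t≤k , p)
                      (anyUpTo? P? (suc k))

leastFrom : {P : ℕ → Set} → (∀ p → Dec (P p)) → ∀ lo hi → lo ≤ hi → P hi →
  ∃[ p ] (lo ≤ p × p ≤ hi × P p × (∀ q → lo ≤ q → q < p → ¬ P q))
leastFrom {P} P? lo hi lo≤hi Phi =
  let p , lo≤p , p≤ , Pp , below = go (hi ∸ lo) lo (subst P (sym (m∸n+n≡m lo≤hi)) Phi)
  in  p , lo≤p , ≤-trans p≤ (≤-reflexive (m∸n+n≡m lo≤hi)) , Pp , below
  where
  go : ∀ d lo → P (d + lo) → ∃[ p ] (lo ≤ p × p ≤ d + lo × P p × (∀ q → lo ≤ q → q < p → ¬ P q))
  go d lo Pd+lo with P? lo
  ... | yes Plo = lo , ≤-refl , m≤n+m lo d , Plo , λ q lo≤q q<lo _ → <-irrefl refl (≤-<-trans lo≤q q<lo)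
  go zero lo Plo | no ¬Plo = ⊥-elim (¬Plo Plo)
  go (suc d) lo Pd+lo | no ¬Plo with go d (suc lo) (subst P (sym (+-suc d lo)) Pd+lo)
  ... | p , lo<p , p≤ , Pp , below = p , <⇒≤ lo<p , ≤-trans p≤ (≤-reflexive (+-suc d lo)) , Pp , below′
    where
    below′ : ∀ q → lo ≤ q → q < p → ¬ P q
    below′ q lo≤q q<p with m≤n⇒m<n∨m≡n lo≤q
    ... | inj₁ lo<q = below q lo<q q<p
    ... | inj₂ refl = ¬Plo

subsetOf : ∀ {k} (P : Fin k → Set) → (∀ i → Dec (P i)) → Subset k
subsetOf P P? = tabulate (λ i → does (P? i))

∈subsetOf⁺ : ∀ {k} {P : Fin k → Set} (P? : ∀ i → Dec (P i)) {i} → P i → i ∈ subsetOf P P?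
∈subsetOf⁺ P? {i} p = lookup⇒[]= i _ (trans (lookup∘tabulate _ i) (dec-true (P? i) p))

∈subsetOf⁻ : ∀ {k} {P : Fin k → Set} (P? : ∀ i → Dec (P i)) {i} → i ∈ subsetOf P P? → P i
∈subsetOf⁻ {P = P} P? {i} i∈ = fromDoes (P? i) (trans (sym (lookup∘tabulate _ i)) ([]=⇒lookup i∈))
  where
  fromDoes : (d : Dec (P i)) → does d ≡ true → P i
  fromDoes (yes p) _ = p

module Walks (G : Graph) where
  open Graph G

  joinsSym : ∀ {e a b} → Joins e a b → Joins e b a
  joinsSym (inj₁ p) = inj₂ p
  joinsSym (inj₂ p) = inj₁ p

  joinsCong : ∀ {e e′ a a′ b b′} → e ≡ e′ → a ≡ a′ → b ≡ b′ → Joins e a b → Joins e′ a′ b′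
  joinsCong refl refl refl j = j

  joins? : ∀ e a b → Dec (Joins e a b)
  joins? e a b = ≡-dec F._≟_ F._≟_ (ends e) (a , b) ⊎-dec ≡-dec F._≟_ F._≟_ (ends e) (b , a)

  joinsNeq : ∀ {e a b} → Joins e a b → a ≢ b
  joinsNeq {e} (inj₁ q) refl = loopless e (trans (cong proj₁ q) (sym (cong proj₂ q)))
  joinsNeq {e} (inj₂ q) refl = loopless e (trans (cong proj₁ q) (sym (cong proj₂ q)))

  joinsMem : ∀ {e a b} {S : Subset n} → Joins e a b →
             proj₁ (ends e) ∈ S → proj₂ (ends e) ∈ S → a ∈ S × b ∈ S
  joinsMem {S = S} (inj₁ q) h₁ h₂ = subst (_∈ S) (cong proj₁ q) h₁ , subst (_∈ S) (cong proj₂ q) h₂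
  joinsMem {S = S} (inj₂ q) h₁ h₂ = subst (_∈ S) (cong proj₂ q) h₂ , subst (_∈ S) (cong proj₁ q) h₁

  endsMem : ∀ {e a b} {S : Subset n} → Joins e a b →
            a ∈ S → b ∈ S → proj₁ (ends e) ∈ S × proj₂ (ends e) ∈ S
  endsMem {S = S} (inj₁ q) h₁ h₂ = subst (_∈ S) (sym (cong proj₁ q)) h₁ , subst (_∈ S) (sym (cong proj₂ q)) h₂
  endsMem {S = S} (inj₂ q) h₁ h₂ = subst (_∈ S) (sym (cong proj₁ q)) h₂ , subst (_∈ S) (sym (cong proj₂ q)) h₁

  module _ {P : Fin n → Set} {Q : Fin m → Set} where
    private
      W = Walk G P Q

    -- The t-th vertex of a walk (its last vertex for t ≥ its length).
    wv : ∀ {a b k} → W a b k → ℕ → Fin n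
    wv {a = a} (nil _) _ = a
    wv (cons {x = a} _ _ _ _ _) zero = a
    wv (cons _ _ _ _ w) (suc t) = wv w t

    -- The t-th edge of a walk, meaningful for t below its length (d is a default value).
    we : ∀ {a b k} → Fin m → W a b k → ℕ → Fin m
    we d (nil _) _ = d
    we d (cons e _ _ _ _) zero = e
    we d (cons _ _ _ _ w) (suc t) = we d w t

    wv0 : ∀ {a b k} (w : W a b k) → wv w 0 ≡ a
    wv0 (nil _) = refl
    wv0 (cons _ _ _ _ _) = refl

    wvEnd : ∀ {a b k} (w : W a b k) → ∀ t → k ≤ t → wv w t ≡ b
    wvEnd (nil _) t _ = refl
    wvEnd (cons _ _ _ _ w) (suc t) (s≤s h) = wvEnd w t h

    startOk : ∀ {a b k} → W a b k → P a
    startOk (nil p) = p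
    startOk (cons _ _ _ p _) = p

    wOkE : ∀ {a b k} (w : W a b k) → ∀ d t → t < k → Q (we d w t)
    wOkE (cons _ q _ _ _) d zero _ = q
    wOkE (cons _ _ _ _ w) d (suc t) (s≤s h) = wOkE w d t h

    wJoin : ∀ {a b k} (w : W a b k) → ∀ d t → t < k → Joins (we d w t) (wv w t) (wv w (suc t))
    wJoin (cons e _ j _ w) d zero _ = subst (Joins e _) (sym (wv0 w)) j
    wJoin (cons _ _ _ _ w) d (suc t) (s≤s h) = wJoin w d t h

    _++w_ : ∀ {a b c k k′} → W a b k → W b c k′ → W a c (k + k′)
    nil _ ++w v = v
    cons e q j p w ++w v = cons e q j p (w ++w v)

    revW : ∀ {a b k} → W a b k → W b a k
    revW (nil p) = nil p
    revW {k = suc k} (cons e q j p w) =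
      subst (W _ _) (+-comm k 1) (revW w ++w cons e q (joinsSym j) (startOk w) (nil p))

    dropW : ∀ {a b k} (w : W a b k) t → t ≤ k → W (wv w t) b (k ∸ t)
    dropW (nil p) zero _ = nil p
    dropW (cons e q j p w) zero _ = cons e q j p w
    dropW (cons _ _ _ _ w) (suc t) (s≤s h) = dropW w t h

    wvDrop : ∀ {a b k} (w : W a b k) t (h : t ≤ k) s → wv (dropW w t h) s ≡ wv w (t + s)
    wvDrop (nil _) zero _ s = refl
    wvDrop (cons _ _ _ _ _) zero _ s = refl
    wvDrop (cons _ _ _ _ w) (suc t) (s≤s h) s = wvDrop w t h s

    weDrop : ∀ {a b k} (w : W a b k) t (h : t ≤ k) d s → we d (dropW w t h) s ≡ we d w (t + s)
    weDrop (nil _) zero _ d s = refl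
    weDrop (cons _ _ _ _ _) zero _ d s = refl
    weDrop (cons _ _ _ _ w) (suc t) (s≤s h) d s = weDrop w t h d s

    takeW : ∀ {a b k} (w : W a b k) t → t ≤ k → W a (wv w t) t
    takeW (nil p) zero _ = nil p
    takeW (cons _ _ _ p _) zero _ = nil p
    takeW (cons e q j p w) (suc t) (s≤s h) = cons e q j p (takeW w t h)

    wvTake : ∀ {a b k} (w : W a b k) t (h : t ≤ k) s → s ≤ t → wv (takeW w t h) s ≡ wv w s
    wvTake (nil _) zero _ s _ = refl
    wvTake (cons _ _ _ _ _) zero _ zero _ = refl
    wvTake (cons _ _ _ _ _) (suc t) (s≤s h) zero _ = refl
    wvTake (cons _ _ _ _ w) (suc t) (s≤s h) (suc s) (s≤s h′) = wvTake w t h s h′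

    weTake : ∀ {a b k} (w : W a b k) t (h : t ≤ k) d s → s < t → we d (takeW w t h) s ≡ we d w s
    weTake (cons _ _ _ _ _) (suc t) (s≤s h) d zero _ = refl
    weTake (cons _ _ _ _ w) (suc t) (s≤s h) d (suc s) (s≤s h′) = weTake w t h d s h′

    IsPath : ∀ {a b k} → W a b k → Set
    IsPath {k = k} w = ∀ s t → s ≤ k → t ≤ k → wv w s ≡ wv w t → s ≡ t

    -- Every walk can be shortened to a path with the same ends: cut out the closed
    -- detour between the first vertex and its last return.
    shorten : ∀ {a b k} → W a b k → ∃[ k′ ] Σ[ w′ ∈ W a b k′ ] IsPath w′
    shorten (nil p) = 0 , nil p , λ { .0 .0 z≤n z≤n _ → refl }
    shorten {a = a} (cons e q j p w) with shorten w
    ... | k′ , w′ , path′ with anyUpTo≤? (λ t → wv w′ t F.≟ a) k′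
    ... | yes (t , t≤k′ , refl) = k′ ∸ t , dropW w′ t t≤k′ , pathDrop
      where
      pathDrop : IsPath (dropW w′ t t≤k′)
      pathDrop s₁ s₂ h₁ h₂ eq = +-cancelˡ-≡ t s₁ s₂
        (path′ (t + s₁) (t + s₂) (bound s₁ h₁) (bound s₂ h₂)
          (trans (sym (wvDrop w′ t t≤k′ s₁)) (trans eq (wvDrop w′ t t≤k′ s₂))))
        where
        bound : ∀ s → s ≤ k′ ∸ t → t + s ≤ k′
        bound s h = ≤-trans (+-monoʳ-≤ t h) (≤-reflexive (m+[n∸m]≡n t≤k′))
    ... | no a∉w′ = suc k′ , cons e q j p w′ , pathCons
      where
      pathCons : IsPath (cons e q j p w′)
      pathCons zero zero _ _ _ = refl
      pathCons zero (suc t) _ (s≤s h) eq = ⊥-elim (a∉w′ (t , h , sym eq))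
      pathCons (suc s) zero (s≤s h) _ eq = ⊥-elim (a∉w′ (s , h , eq))
      pathCons (suc s) (suc t) (s≤s h₁) (s≤s h₂) eq = cong suc (path′ s t h₁ h₂ eq)

    pathLength< : ∀ {a b k} (w : W a b k) → IsPath w → k < n
    pathLength< w path = injective⇒≤ {f = λ i → wv w (toℕ i)}
      (λ {i} {j} eq → toℕ-injective (path (toℕ i) (toℕ j) (s≤s⁻¹ (toℕ<n i)) (s≤s⁻¹ (toℕ<n j)) eq))

    -- Reachability is decidable: search walks of each length below n.
    module _ (P? : ∀ a → Dec (P a)) (Q? : ∀ e → Dec (Q e)) where
      decWalk : ∀ a b k → Dec (W a b k)
      decWalk a b zero with a F.≟ b | P? a
      ... | yes refl | yes p = yes (nil p)
      ... | yes refl | no ¬p = no λ { (nil p) → ¬p p }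
      ... | no a≢b   | _     = no λ { (nil _) → a≢b refl }
      decWalk a b (suc k) with P? a | any? (λ e → any? (λ y → Q? e ×-dec (joins? e a y ×-dec decWalk y b k)))
      ... | no ¬p | _ = no λ { (cons _ _ _ p _) → ¬p p }
      ... | yes p | yes (e , y , q , j , w) = yes (cons e q j p w)
      ... | yes p | no ¬step = no λ { (cons e q j _ w) → ¬step (e , _ , q , j , w) }

      decReach : ∀ a b → Dec (∃[ k ] W a b k)
      decReach a b with anyUpTo? (decWalk a b) n
      ... | yes (k , _ , w) = yes (k , w)
      ... | no ¬short = no λ (k , w) →
              let k′ , w′ , path = shorten w in ¬short (k′ , pathLength< w′ path , w′)

  retype : ∀ {P Q P′ Q′} d {a b k} (w : Walk G P Q a b k) →
           (∀ t → t ≤ k → P′ (wv w t)) → (∀ t → t < k → Q′ (we d w t)) → Walk G P′ Q′ a b k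
  retype d (nil _) okV okE = nil (okV 0 z≤n)
  retype d (cons e _ j _ w) okV okE =
    cons e (okE 0 (s≤s z≤n)) j (okV 0 z≤n)
         (retype d w (λ t h → okV (suc t) (s≤s h)) (λ t h → okE (suc t) (s≤s h)))

  mapW : ∀ {P Q P′ Q′} → (∀ {z} → P z → P′ z) → (∀ {f} → Q f → Q′ f) →
         ∀ {a b k} → Walk G P Q a b k → Walk G P′ Q′ a b k
  mapW fV fE (nil p) = nil (fV p)
  mapW fV fE (cons e q j p w) = cons e (fE q) j (fV p) (mapW fV fE w)

  incidentEdge : Connected G → ∀ v a → a ≢ v → ∃[ e ] ∃[ y ] Joins e v y
  incidentEdge conn v a a≢v with proj₂ conn v a tt tt
  ... | zero , nil _ = ⊥-elim (a≢v refl)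
  ... | suc _ , cons e _ j _ _ = e , _ , j

  decCut : ∀ v → Dec (IsCut G v)
  decCut v = yes tt ×-dec any? λ a → any? λ b →
    yes tt ×-dec (yes tt ×-dec (¬? (a F.≟ v) ×-dec (¬? (b F.≟ v) ×-dec ¬? (reachAvoiding? a b))))
    where
    reachAvoiding? : ∀ a b → Dec (∃[ k ] Walk G (λ u → ⊤ × u ≢ v) (AllE G) a b k)
    reachAvoiding? = decReach (λ u → yes tt ×-dec ¬? (u F.≟ v)) (λ _ → yes tt)

  -- v is at the same distance from both ends of e (the second half of IsAntipode).
  Equidistant : Fin n → Fin m → Set
  Equidistant v e = ∃[ k ] (Dist G v (proj₁ (ends e)) k × Dist G v (proj₂ (ends e)) k)

  unequalDistances : ∀ {v w k} → v ≢ w → Dist G v v k → Dist G v w k → ⊥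
  unequalDistances v≢w (_ , minimal) d with n≤0⇒n≡0 (minimal 0 (nil tt))
  unequalDistances v≢w _ (nil _ , _) | refl = v≢w refl

  -- No vertex is equidistant from the ends of an edge at it: one end is at distance 0.
  notEquidistantAtEnd : ∀ {e v w} → Joins e v w → ¬ Equidistant v e
  notEquidistantAtEnd {v = v} j@(inj₁ q) (k , d₁ , d₂) =
    unequalDistances (joinsNeq j) (subst (λ p → Dist G v (proj₁ p) k) q d₁) (subst (λ p → Dist G v (proj₂ p) k) q d₂)
  notEquidistantAtEnd {v = v} j@(inj₂ q) (k , d₁ , d₂) =
    unequalDistances (joinsNeq j) (subst (λ p → Dist G v (proj₂ p) k) q d₂) (subst (λ p → Dist G v (proj₁ p) k) q d₁)

  decDist : ∀ v a k → Dec (Dist G v a k)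
  decDist v a k = decWalkG v a k ×-dec map′ noShorter noShorter⁻ (¬? (anyUpTo? (decWalkG v a) k))
    where
    decWalkG : ∀ a b k → Dec (Walk G (AllV G) (AllE G) a b k)
    decWalkG = decWalk (λ _ → yes tt) (λ _ → yes tt)
    noShorter : ¬ (∃[ k′ ] (k′ < k × Walk G (AllV G) (AllE G) v a k′)) →
                ∀ k′ → Walk G (AllV G) (AllE G) v a k′ → k ≤ k′
    noShorter ¬w k′ w = ≮⇒≥ (λ k′<k → ¬w (k′ , k′<k , w))
    noShorter⁻ : (∀ k′ → Walk G (AllV G) (AllE G) v a k′ → k ≤ k′) →
                 ¬ (∃[ k′ ] (k′ < k × Walk G (AllV G) (AllE G) v a k′))
    noShorter⁻ minimal (k′ , k′<k , w) = <-irrefl refl (<-≤-trans k′<k (minimal k′ w))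

  -- In a connected graph every distance is below n (a shortest walk is a path).
  distBound : Connected G → ∀ {v a k} → Dist G v a k → k < n
  distBound conn {v} {a} (_ , minimal) =
    let k′ , w′ , path = shorten (proj₂ (proj₂ conn v a tt tt))
    in  ≤-<-trans (minimal k′ w′) (pathLength< w′ path)

  -- In a connected graph equidistance is decidable: only distances below n need checking.
  decEquidistant : Connected G → ∀ v e → Dec (Equidistant v e)
  decEquidistant conn v e with anyUpTo? (λ k → decDist v (proj₁ (ends e)) k ×-dec decDist v (proj₂ (ends e)) k) n
  ... | yes (k , _ , d) = yes (k , d)
  ... | no ¬small = no λ (k , d₁ , d₂) → ¬small (k , distBound conn d₁ , d₁ , d₂)

module ClosingCycle (G : Graph) where
  open Graph G
  open Walks G

  closeCycle : ∀ {P Q e₀ c u l} → Joins e₀ c u → (π : Walk G P Q u c (2 + l)) → IsPath π →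
    Σ[ C ∈ Cycle G ] (IsCycle G C × _∈E_ G e₀ C ×
                      (∀ f → _∈E_ G f C → f ≡ e₀ ⊎ ∃[ t ] (t < 2 + l × we e₀ π t ≡ f)))
  closeCycle {e₀ = e₀} {c} {u} {l} j₀ π pathπ = C , (vertInj , edgeJoins) , (F.zero , refl) , edgeOrigin
    where
    N = 3 + l

    -- the closed walk c, e₀, u = π₀, π₁, … , π_{N-1} = c, indexed by ℕ
    cv : ℕ → Fin n
    cv zero = c
    cv (suc t) = wv π t

    ce : ℕ → Fin m
    ce zero = e₀
    ce (suc t) = we e₀ π t

    cvFin : Fin N → Fin n
    cvFin i = cv (toℕ i)

    ceFin : Fin N → Fin m
    ceFin i = ce (toℕ i)

    C : Cycle G
    C = mkCycle l (tabulate cvFin) (tabulate ceFin)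

    vertC : ∀ i → vert C i ≡ cv (i % N)
    vertC i = trans (lookup∘tabulate cvFin (i mod N)) (cong cv (toℕ-fromℕ< (m%n<n i N)))

    edgeC : ∀ i → edge C i ≡ ce (i % N)
    edgeC i = trans (lookup∘tabulate ceFin (i mod N)) (cong ce (toℕ-fromℕ< (m%n<n i N)))

    cvEnd : cv N ≡ c
    cvEnd = wvEnd π (2 + l) ≤-refl

    cvJoin : ∀ t → t < N → Joins (ce t) (cv t) (cv (suc t))
    cvJoin zero _ = subst (Joins e₀ c) (sym (wv0 π)) j₀
    cvJoin (suc t) (s≤s t<L) = wJoin π e₀ t t<L

    -- stepping past the last index wraps around to c
    cvNext : ∀ i → cv (suc (i % N)) ≡ cv (suc i % N)
    cvNext i with m≤n⇒m<n∨m≡n (m%n<n i N)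
    ... | inj₁ i%N+1<N = cong cv (sym (trans (%-distribˡ-+ 1 i N) (m<n⇒m%n≡m i%N+1<N)))
    ... | inj₂ i%N+1≡N = begin
      cv (suc (i % N))        ≡⟨ cong cv i%N+1≡N ⟩
      cv N                    ≡⟨ cvEnd ⟩
      c                       ≡⟨ cong cv (sym (n%n≡0 N)) ⟩
      cv (N % N)              ≡⟨ cong (λ r → cv (r % N)) (sym i%N+1≡N) ⟩
      cv (suc (i % N) % N)    ≡⟨ cong cv (sym (%-distribˡ-+ 1 i N)) ⟩
      cv (suc i % N)          ∎
      where open ≡-Reasoning

    cNotInside : ∀ t → t < 2 + l → wv π t ≢ c
    cNotInside t t<L eq = <-irrefl (pathπ t (2 + l) (<⇒≤ t<L) ≤-refl (trans eq (sym cvEnd))) t<L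

    cvInj : ∀ s t → s < N → t < N → cv s ≡ cv t → s ≡ t
    cvInj zero zero _ _ _ = refl
    cvInj zero (suc t) _ (s≤s t<L) eq = ⊥-elim (cNotInside t t<L (sym eq))
    cvInj (suc s) zero (s≤s s<L) _ eq = ⊥-elim (cNotInside s s<L eq)
    cvInj (suc s) (suc t) (s≤s s<L) (s≤s t<L) eq = cong suc (pathπ s t (<⇒≤ s<L) (<⇒≤ t<L) eq)

    vertInj : ∀ i j → lookup (vs C) i ≡ lookup (vs C) j → i ≡ j
    vertInj i j eq = toℕ-injective (cvInj (toℕ i) (toℕ j) (toℕ<n i) (toℕ<n j)
      (trans (sym (lookup∘tabulate cvFin i)) (trans eq (lookup∘tabulate cvFin j))))

    edgeJoins : ∀ i → Joins (edge C i) (vert C i) (vert C (suc i))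
    edgeJoins i = joinsCong (sym (edgeC i)) (sym (vertC i)) (trans (cvNext i) (sym (vertC (suc i))))
                            (cvJoin (i % N) (m%n<n i N))

    originOf : ∀ {f} t → t < N → ce t ≡ f → f ≡ e₀ ⊎ ∃[ t′ ] (t′ < 2 + l × we e₀ π t′ ≡ f)
    originOf zero _ eq = inj₁ (sym eq)
    originOf (suc t) (s≤s t<L) eq = inj₂ (t , t<L , eq)

    edgeOrigin : ∀ f → _∈E_ G f C → f ≡ e₀ ⊎ ∃[ t ] (t < 2 + l × we e₀ π t ≡ f)
    edgeOrigin f (i , eq) = originOf (toℕ i) (toℕ<n i) (trans (sym (lookup∘tabulate ceFin i)) eq)

module SingleEdge (G : Graph) {e c y} (j : Graph.Joins G e c y) where
  open Graph G
  open Walks G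

  IsEnd : Fin n → Set
  IsEnd z = z ≡ c ⊎ z ≡ y

  isEnd? : ∀ z → Dec (IsEnd z)
  isEnd? z = (z F.≟ c) ⊎-dec (z F.≟ y)

  isE? : ∀ f → Dec (f ≡ e)
  isE? f = f F.≟ e

  closedH : ∀ f → f ∈ subsetOf (_≡ e) isE? →
            proj₁ (ends f) ∈ subsetOf IsEnd isEnd? × proj₂ (ends f) ∈ subsetOf IsEnd isEnd?
  closedH f f∈ with ∈subsetOf⁻ isE? f∈
  ... | refl = endsMem j (∈subsetOf⁺ isEnd? (inj₁ refl)) (∈subsetOf⁺ isEnd? (inj₂ refl))

  H : Subgraph G
  H = record { V = subsetOf IsEnd isEnd? ; E = subsetOf (_≡ e) isE? ; closed = closedH }

  sameOther : ∀ {a b v} → IsEnd a → IsEnd b → IsEnd v → a ≢ v → b ≢ v → a ≡ b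
  sameOther (inj₁ refl) (inj₁ refl) _ _ _ = refl
  sameOther (inj₂ refl) (inj₂ refl) _ _ _ = refl
  sameOther (inj₁ refl) (inj₂ refl) (inj₁ refl) a≢v _ = ⊥-elim (a≢v refl)
  sameOther (inj₁ refl) (inj₂ refl) (inj₂ refl) _ b≢v = ⊥-elim (b≢v refl)
  sameOther (inj₂ refl) (inj₁ refl) (inj₁ refl) _ b≢v = ⊥-elim (b≢v refl)
  sameOther (inj₂ refl) (inj₁ refl) (inj₂ refl) a≢v _ = ⊥-elim (a≢v refl)

  connectedH : ∀ a b → a ∈ V H → b ∈ V H → ∃[ k ] Walk G (_∈ V H) (_∈ E H) a b k
  connectedH a b a∈ b∈ with ∈subsetOf⁻ isEnd? a∈ | ∈subsetOf⁻ isEnd? b∈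
  ... | inj₁ refl | inj₁ refl = 0 , nil a∈
  ... | inj₂ refl | inj₂ refl = 0 , nil a∈
  ... | inj₁ refl | inj₂ refl = 1 , cons e (∈subsetOf⁺ isE? refl) j a∈ (nil b∈)
  ... | inj₂ refl | inj₁ refl = 1 , cons e (∈subsetOf⁺ isE? refl) (joinsSym j) a∈ (nil b∈)

  noCutH : ∀ v → ¬ CutVertexOn G (_∈ V H) (_∈ E H) v
  noCutH v (v∈ , a , b , a∈ , b∈ , a≢v , b≢v , ¬walk)
    with sameOther (∈subsetOf⁻ isEnd? a∈) (∈subsetOf⁻ isEnd? b∈) (∈subsetOf⁻ isEnd? v∈) a≢v b≢v
  ... | refl = ¬walk (0 , nil (a∈ , a≢v))

  connectedNoCut : ConnectedNoCut G H
  connectedNoCut = ((c , ∈subsetOf⁺ isEnd? (inj₁ refl)) , connectedH) , noCutH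

module Blocks (G : Graph) (B : Subgraph G) (blk : IsBlock G B) where
  open Graph G
  open Walks G
  open ClosingCycle G

  private
    connB : ∀ a b → a ∈ V B → b ∈ V B → ∃[ k ] Walk G (_∈ V B) (_∈ E B) a b k
    connB = proj₂ (proj₁ (proj₁ blk))

    noCutB : ∀ v → ¬ CutVertexOn G (_∈ V B) (_∈ E B) v
    noCutB = proj₂ (proj₁ blk)

    maximal : ∀ H → _≤H_ G B H → ConnectedNoCut G H → _≤H_ G H B
    maximal = proj₂ blk

  -- A vertex c of B with an incident edge in G has an incident edge in B: either B has a
  -- second vertex, reached from c inside B, or B ⊆ {c} lies in the single edge at c.
  blockEdgeAt : ∀ {e c y} → c ∈ V B → Joins e c y → ∃[ e′ ] ∃[ u ] (e′ ∈ E B × Joins e′ c u)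
  blockEdgeAt {e} {c} {y} c∈B j with any? (λ w → (w ∈? V B) ×-dec ¬? (w F.≟ c))
  ... | yes (w , w∈B , w≢c) with connB c w c∈B w∈B
  ...   | zero , nil _ = ⊥-elim (w≢c refl)
  ...   | suc _ , cons e′ e′∈B j′ _ _ = e′ , _ , e′∈B , j′
  blockEdgeAt {e} {c} {y} c∈B j | no noOther =
    e , y , proj₂ (maximal H B≤H connectedNoCut) (∈subsetOf⁺ isE? refl) , j
    where
    open SingleEdge G j
    onlyC : ∀ {z} → z ∈ V B → z ≡ c
    onlyC {z} z∈B with z F.≟ c
    ... | yes z≡c = z≡c
    ... | no z≢c = ⊥-elim (noOther (z , z∈B , z≢c))
    B≤H : _≤H_ G B H
    B≤H = (λ z∈B → ∈subsetOf⁺ isEnd? (inj₁ (onlyC z∈B))) ,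
          (λ {f} f∈B → ⊥-elim (loopless f (trans (onlyC (proj₁ (closed B f f∈B)))
                                                 (sym (onlyC (proj₂ (closed B f f∈B)))))))

  -- B minus a vertex v stays connected, since B has no cut vertex (stated doubly negated,
  -- as that is how the absence of cut vertices is given).
  connectedAvoiding : ∀ v {x y} → x ∈ V B → y ∈ V B → x ≢ v → y ≢ v →
    ¬ ¬ (∃[ k ] Walk G (λ z → z ∈ V B × z ≢ v) (_∈ E B) x y k)
  connectedAvoiding v x∈B y∈B x≢v y≢v ¬walk with v ∈? V B
  ... | yes v∈B = noCutB v (v∈B , _ , _ , x∈B , y∈B , x≢v , y≢v , ¬walk)
  ... | no v∉B = ¬walk (_ , mapW (λ {z} z∈B → z∈B , λ z≡v → v∉B (subst (_∈ V B) z≡v z∈B)) (λ f∈B → f∈B)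
                                 (proj₂ (connB _ _ x∈B y∈B)))

  -- Ear lemma: a path π between two vertices a, b of B runs inside B, because B together
  -- with π is still connected without cut vertex.
  module Ear {P Q a b L} (d : Fin m) (π : Walk G P Q a b L) (pathπ : IsPath π)
             (a∈B : a ∈ V B) (b∈B : b ∈ V B) where

    OnV : Fin n → Set
    OnV z = z ∈ V B ⊎ ∃[ t ] (t ≤ L × wv π t ≡ z)

    OnV? : ∀ z → Dec (OnV z)
    OnV? z = (z ∈? V B) ⊎-dec anyUpTo≤? (λ t → wv π t F.≟ z) L

    OnE : Fin m → Set
    OnE f = f ∈ E B ⊎ ∃[ t ] (t < L × we d π t ≡ f)

    OnE? : ∀ f → Dec (OnE f)
    OnE? f = (f ∈? E B) ⊎-dec anyUpTo? (λ t → we d π t F.≟ f) L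

    VH = subsetOf OnV OnV?
    EH = subsetOf OnE OnE?

    fromB : ∀ {z} → z ∈ V B → z ∈ VH
    fromB z∈B = ∈subsetOf⁺ OnV? (inj₁ z∈B)

    fromBᴱ : ∀ {f} → f ∈ E B → f ∈ EH
    fromBᴱ f∈B = ∈subsetOf⁺ OnE? (inj₁ f∈B)

    onV : ∀ t → t ≤ L → wv π t ∈ VH
    onV t t≤L = ∈subsetOf⁺ OnV? (inj₂ (t , t≤L , refl))

    onE : ∀ t → t < L → we d π t ∈ EH
    onE t t<L = ∈subsetOf⁺ OnE? (inj₂ (t , t<L , refl))

    closedH : ∀ f → f ∈ EH → proj₁ (ends f) ∈ VH × proj₂ (ends f) ∈ VH
    closedH f f∈ with ∈subsetOf⁻ OnE? f∈
    ... | inj₁ f∈B = fromB (proj₁ (closed B f f∈B)) , fromB (proj₂ (closed B f f∈B))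
    ... | inj₂ (t , t<L , refl) = endsMem (wJoin π d t t<L) (onV t (<⇒≤ t<L)) (onV (suc t) t<L)

    H : Subgraph G
    H = record { V = VH ; E = EH ; closed = closedH }

    tailBound : ∀ {t} s → t ≤ L → s ≤ L ∸ t → t + s ≤ L
    tailBound {t} s t≤L s≤ = ≤-trans (+-monoʳ-≤ t s≤) (≤-reflexive (m+[n∸m]≡n t≤L))

    prefix : ∀ {R} t (t≤L : t ≤ L) → (∀ s → s ≤ t → R (wv π s)) → Walk G R (_∈ EH) a (wv π t) t
    prefix {R} t t≤L okR = retype d (takeW π t t≤L)
      (λ s s≤t → subst R (sym (wvTake π t t≤L s s≤t)) (okR s s≤t))
      (λ s s<t → subst (_∈ EH) (sym (weTake π t t≤L d s s<t)) (onE s (<-≤-trans s<t t≤L)))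

    suffix : ∀ {R} t (t≤L : t ≤ L) → (∀ s → s ≤ L ∸ t → R (wv π (t + s))) →
             Walk G R (_∈ EH) (wv π t) b (L ∸ t)
    suffix {R} t t≤L okR = retype d (dropW π t t≤L)
      (λ s s≤ → subst R (sym (wvDrop π t t≤L s)) (okR s s≤))
      (λ s s< → subst (_∈ EH) (sym (weDrop π t t≤L d s))
                      (onE (t + s) (≤-trans (≤-reflexive (sym (+-suc t s))) (tailBound (suc s) t≤L s<))))

    anchor : ∀ z → z ∈ VH → ∃[ s ] (s ∈ V B × ∃[ k ] Walk G (_∈ VH) (_∈ EH) s z k)
    anchor z z∈ with ∈subsetOf⁻ OnV? z∈
    ... | inj₁ z∈B = z , z∈B , 0 , nil z∈
    ... | inj₂ (t , t≤L , refl) = a , a∈B , t , prefix t t≤L (λ s s≤t → onV s (≤-trans s≤t t≤L))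

    connectedH : ∀ x y → x ∈ VH → y ∈ VH → ∃[ k ] Walk G (_∈ VH) (_∈ EH) x y k
    connectedH x y x∈ y∈ =
      let sx , sx∈B , _ , wx = anchor x x∈
          sy , sy∈B , _ , wy = anchor y y∈
          _ , wB = connB sx sy sx∈B sy∈B
      in  _ , revW wx ++w (mapW fromB fromBᴱ wB ++w wy)

    -- every vertex z ≠ v of H is reached inside H − v from a vertex of B: backwards along π
    -- to a if v does not occur on π before z, otherwise forwards to b (π meets v once)
    anchorAvoiding : ∀ v z → z ∈ VH → z ≢ v →
      ∃[ s ] (s ∈ V B × s ≢ v × ∃[ k ] Walk G (λ y → y ∈ VH × y ≢ v) (_∈ EH) s z k)
    anchorAvoiding v z z∈ z≢v with ∈subsetOf⁻ OnV? z∈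
    ... | inj₁ z∈B = z , z∈B , z≢v , 0 , nil (z∈ , z≢v)
    ... | inj₂ (t , t≤L , refl) with anyUpTo≤? (λ s → wv π s F.≟ v) t
    ...   | no vNotBefore =
            a , a∈B , (λ a≡v → vNotBefore (0 , z≤n , trans (wv0 π) a≡v)) , t ,
            prefix t t≤L (λ s s≤t → onV s (≤-trans s≤t t≤L) , λ πs≡v → vNotBefore (s , s≤t , πs≡v))
    ...   | yes (i , i≤t , πi≡v) =
            b , b∈B , b≢v , L ∸ t , revW (suffix t t≤L (λ s s≤ → onV (t + s) (tailBound s t≤L s≤) , after s s≤))
      where
      after : ∀ s → s ≤ L ∸ t → wv π (t + s) ≢ v
      after s s≤ πt+s≡v = z≢v (subst (λ r → wv π r ≡ v) i≡t πi≡v)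
        where
        t+s≡i : t + s ≡ i
        t+s≡i = pathπ (t + s) i (tailBound s t≤L s≤) (≤-trans i≤t t≤L) (trans πt+s≡v (sym πi≡v))
        i≡t : i ≡ t
        i≡t = ≤-antisym i≤t (≤-trans (m≤m+n t s) (≤-reflexive t+s≡i))
      b≢v : b ≢ v
      b≢v b≡v = after (L ∸ t) ≤-refl (trans (cong (wv π) (m+[n∸m]≡n t≤L)) (trans (wvEnd π L ≤-refl) b≡v))

    noCutH : ∀ v → ¬ CutVertexOn G (_∈ VH) (_∈ EH) v
    noCutH v (_ , x , y , x∈ , y∈ , x≢v , y≢v , ¬walk) =
      let sx , sx∈B , sx≢v , _ , wx = anchorAvoiding v x x∈ x≢v
          sy , sy∈B , sy≢v , _ , wy = anchorAvoiding v y y∈ y≢v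
      in  connectedAvoiding v sx∈B sy∈B sx≢v sy≢v λ (_ , wB) →
            ¬walk (_ , revW wx ++w (mapW (λ (z∈B , z≢v) → fromB z∈B , z≢v) fromBᴱ wB ++w wy))

    pathInBlock : ∀ t → t < L → we d π t ∈ E B
    pathInBlock t t<L = proj₂ (maximal H (fromB , fromBᴱ) (((a , fromB a∈B) , connectedH) , noCutH)) (onE t t<L)

  -- An edge e₀ = cu of B that is not a cut edge lies on a cycle of G inside B: close a
  -- shortest return path from u to c avoiding e₀ (it has length ≥ 2) by e₀.
  cycleThroughEdge : ∀ {e₀ c u} → e₀ ∈ E B → Joins e₀ c u →
    ∃[ k ] Walk G (AllV G) (λ f → f ≢ e₀) u c k →
    ∃[ C ] (IsCycle G C × _∈E_ G e₀ C × (∀ f → _∈E_ G f C → f ∈ E B))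
  cycleThroughEdge {e₀} {c} {u} e₀∈B j₀ (_ , w) with shorten w
  ... | zero , π , _ = ⊥-elim (joinsNeq j₀ (trans (sym (wvEnd π 0 z≤n)) (wv0 π)))
  ... | suc zero , π , _ =
        ⊥-elim (wOkE π e₀ 0 (s≤s z≤n) (noParallel _ e₀ u c
                  (joinsCong refl (wv0 π) (wvEnd π 1 ≤-refl) (wJoin π e₀ 0 (s≤s z≤n))) (joinsSym j₀)))
  ... | suc (suc l) , π , pathπ with closeCycle j₀ π pathπ
  ...   | C , isC , e₀∈C , origin = C , isC , e₀∈C , λ f f∈C → inB (origin f f∈C)
    where
    ends∈B : c ∈ V B × u ∈ V B
    ends∈B = joinsMem j₀ (proj₁ (closed B e₀ e₀∈B)) (proj₂ (closed B e₀ e₀∈B))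
    inB : ∀ {f} → f ≡ e₀ ⊎ ∃[ t ] (t < 2 + l × we e₀ π t ≡ f) → f ∈ E B
    inB (inj₁ refl) = e₀∈B
    inB (inj₂ (t , t<L , refl)) = Ear.pathInBlock e₀ π pathπ (proj₂ ends∈B) (proj₁ ends∈B) t t<L

toℕ-mod : ∀ {k} (i : Fin (suc k)) → toℕ i mod suc k ≡ i
toℕ-mod i = toℕ-injective (trans (toℕ-fromℕ< _) (m<n⇒m%n≡m (toℕ<n i)))

self-mod : ∀ k → suc k mod suc k ≡ F.zero
self-mod k = toℕ-injective (trans (toℕ-fromℕ< _) (n%n≡0 (suc k)))

module Segments (G : Graph) (D : Cycle G) where
  open Graph G

  itemVertex : ∀ q i → itemAux G D i (q + q) ≡ inj₁ (vert D (i + q))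
  itemVertex zero i = cong (λ r → inj₁ (vert D r)) (sym (+-identityʳ i))
  itemVertex (suc q) i rewrite +-suc q q =
    trans (itemVertex q (suc i)) (cong (λ r → inj₁ (vert D r)) (sym (+-suc i q)))

  itemEdge : ∀ q i {e} → itemAux G D i q ≡ inj₂ e → _∈E_ G e D
  itemEdge (suc zero) i refl = i mod len D , refl
  itemEdge (suc (suc q)) i eq = itemEdge q (suc i) eq

  lastItem : x G D (2 * len D + 1) ≡ inj₁ (lookup (vs D) F.zero)
  lastItem = begin
    itemAux G D 0 (2 * len D + 1 ∸ 1)   ≡⟨ cong (itemAux G D 0) (trans (m+n∸n≡m (2 * len D) 1)
                                                                    (cong (len D +_) (+-identityʳ (len D)))) ⟩
    itemAux G D 0 (len D + len D)       ≡⟨ itemVertex (len D) 0 ⟩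
    inj₁ (lookup (vs D) (len D mod len D)) ≡⟨ cong (λ i → inj₁ (lookup (vs D) i)) (self-mod (2 + l D)) ⟩
    inj₁ (lookup (vs D) F.zero)          ∎
    where open ≡-Reasoning

  -- If markedness of items is decidable, x₁ is a cut vertex and x₂ is unmarked, then x₂
  -- starts a segment of 𝒮₁ ∪ 𝒮₂: it ends before the first marked item after x₂, which
  -- exists since x_{2n(D)+1} = x₁ is marked.
  segmentAtStart : (∀ p → Dec (Marked G (x G D p))) → IsCut G (lookup (vs D) F.zero) →
    ¬ Marked G (x G D 2) → ∃[ k ] ((InS₁ G D 2 k ⊎ InS₂ G D 2 k) × InSegEdges G D 2 k (edge D 0))
  segmentAtStart marked? x₁cut x₂unmarked
    with leastFrom marked? 3 (2 * len D + 1) (s≤s (s≤s (s≤s z≤n))) (subst (Marked G) (sym lastItem) (inj₁ x₁cut))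
  ... | suc (suc (suc k)) , s≤s (s≤s (s≤s _)) , p≤last , endMarked , noneBefore =
        k , boundary endMarked′ , 0 , z≤n , refl
    where
    endMarked′ : Marked G (x G D (2 + k + 1))
    endMarked′ = subst (λ p → Marked G (x G D p)) (cong (λ r → suc (suc r)) (+-comm 1 k)) endMarked
    inside : ∀ ℓ → ℓ ≤ k → ¬ Marked G (x G D (2 + ℓ))
    inside zero _ = x₂unmarked
    inside (suc ℓ) ℓ<k = noneBefore (3 + ℓ) (s≤s (s≤s (s≤s z≤n))) (s≤s (s≤s (s≤s ℓ<k)))
    segment : IsSegment G D 2 k
    segment = ≤-refl , s≤s⁻¹ (≤-trans p≤last (≤-reflexive (+-comm (2 * len D) 1))) ,
              inj₁ x₁cut , endMarked′ , inside
    boundary : Marked G (x G D (2 + k + 1)) → InS₁ G D 2 k ⊎ InS₂ G D 2 k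
    boundary (inj₁ cut) = inj₁ (segment , x₁cut , cut)
    boundary (inj₂ ant) = inj₂ (segment , x₁cut , ant)

module LeafBlock (G : Graph) (conn : Connected G) (cact : OddCactus G) (O : Orientation G)
  (B : Subgraph G) {c : Fin (Graph.n G)} (leaf : ∀ c′ → BCAdj G c′ B → c′ ≡ c)
  {e₀ : Fin (Graph.m G)} (C : Cycle G) (isC : IsCycle G C) (e₀∈C : _∈E_ G e₀ C)
  (C⊆B : ∀ f → _∈E_ G f C → f ∈ E B) where
  open Graph G
  open Walks G

  onCycle : OnCycle G e₀
  onCycle = C , isC , e₀∈C

  D : Cycle G
  D = Orientation.W O e₀

  isD : IsCycle G D
  isD = proj₁ (Orientation.valid O e₀ onCycle)

  e₀∈D : _∈E_ G e₀ D
  e₀∈D = proj₁ (proj₂ (Orientation.valid O e₀ onCycle))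

  startCut : IsCut G (lookup (vs D) F.zero)
  startCut = proj₂ (proj₂ (Orientation.valid O e₀ onCycle))

  -- D shares e₀ with C, so (cactus) has the same edges
  D⊆B : ∀ f → _∈E_ G f D → f ∈ E B
  D⊆B f f∈D = C⊆B f (proj₁ (proj₁ cact D C e₀ isD isC e₀∈D e₀∈C f) f∈D)

  -- likewise every cycle sharing an edge with D has its edges, hence its vertices, in B
  meetingCycleInB : ∀ C′ {g} → IsCycle G C′ → _∈E_ G g C′ → _∈E_ G g D → ∀ {v} → _∈V_ G v C′ → v ∈ V B
  meetingCycleInB C′ {g} isC′ g∈C′ g∈D (i , refl) =
    subst (_∈ V B) (cong (lookup (vs C′)) (toℕ-mod i))
          (proj₁ (joinsMem (proj₂ isC′ (toℕ i)) (proj₁ (closed B f f∈B)) (proj₂ (closed B f f∈B))))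
    where
    f = edge C′ (toℕ i)
    f∈B : f ∈ E B
    f∈B = D⊆B f (proj₁ (proj₁ cact C′ D g isC′ isD g∈C′ g∈D f) (toℕ i mod len C′ , refl))

  -- B is a leaf: c is the only cut vertex of G in B
  onlyCut : ∀ {v} → IsCut G v → v ∈ V B → v ≡ c
  onlyCut cut v∈B = leaf _ (cut , v∈B)

  startIsC : lookup (vs D) F.zero ≡ c
  startIsC = onlyCut startCut (meetingCycleInB D isD e₀∈D e₀∈D (F.zero , refl))

  antOnD : ∀ {e} → _∈E_ G e D → InEant G e → Equidistant c e
  antOnD e∈D (C′ , isC′ , e∈C′ , v , (v∈C′ , equi) , cut)
    with onlyCut cut (meetingCycleInB C′ isC′ e∈C′ e∈D v∈C′)
  ... | refl = equi

  antOnD⁻ : ∀ {e} → _∈E_ G e D → Equidistant c e → InEant G e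
  antOnD⁻ e∈D equi = D , isD , e∈D , c , ((F.zero , startIsC) , equi) , subst (IsCut G) startIsC startCut

  decMarked : ∀ p → Dec (Marked G (x G D p))
  decMarked p = decItem (x G D p) (Segments.itemEdge G D (p ∸ 1) 0)
    where
    decItem : (it : Item G) → (∀ {e} → it ≡ inj₂ e → _∈E_ G e D) → Dec (Marked G it)
    decItem (inj₁ v) _ = decCut v ⊎-dec no (λ ())
    decItem (inj₂ e) onD with decEquidistant conn c e
    ... | yes equi = yes (inj₂ (antOnD⁻ (onD refl) equi))
    ... | no ¬equi = no λ { (inj₁ ()) ; (inj₂ ant) → ¬equi (antOnD (onD refl) ant) }

  -- x₂ is the first edge of D, which is incident with c = x₁
  secondUnmarked : ¬ Marked G (x G D 2)
  secondUnmarked (inj₁ ())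
  secondUnmarked (inj₂ ant) =
    notEquidistantAtEnd (subst (λ v → Joins (edge D 0) v (vert D 1)) startIsC (proj₂ isD 0))
                        (antOnD (F.zero , refl) ant)

  edgeInEB : ∃[ e ] (e ∈ E B × InEB G O e)
  edgeInEB =
    let k , S , x₂∈S = Segments.segmentAtStart G D decMarked startCut secondUnmarked
    in  edge D 0 , D⊆B _ (F.zero , refl) , inj₁ (e₀ , onCycle , 2 , k , S , x₂∈S)

lemma5 : (G : Graph) → Connected G → OddCactus G → ¬ IsCycleGraph G →
         (O : Orientation G) → (B : Subgraph G) → IsBlock G B → IsLeafBlock G B →
         ∃[ e ] (e ∈ E B × InEB G O e)
lemma5 G conn cact _ O B blk (c , ((_ , a , _ , _ , _ , a≢c , _) , c∈B) , leaf)
  with Walks.incidentEdge G conn c a a≢c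
... | _ , _ , j with Blocks.blockEdgeAt G B blk c∈B j
... | e₀ , u , e₀∈B , j₀
    with Walks.decReach G {P = AllV G} {Q = λ f → f ≢ e₀} (λ _ → yes tt) (λ f → ¬? (f F.≟ e₀)) u c
... | no ¬return = e₀ , e₀∈B , inj₂ (u , c , ¬return)
... | yes return =
      let C , isC , e₀∈C , C⊆B = Blocks.cycleThroughEdge G B blk e₀∈B j₀ return
      in  LeafBlock.edgeInEB G conn cact O B leaf C isC e₀∈C C⊆B
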